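{- Let $G$ be an interval graph and let $F\in\mathcal{F}$. If $G$ contains $F$ as an induced subgraph, then $G$ is not an exactly hittable interval graph.
   Context: $\mathcal{F}$ is the family of all interval graphs $F$ such that, for some integer $k\ge 1$, $F$ has an induced path $P$ on $k$ vertices whose open neighbourhood (vertices not on $P$ adjacent to some vertex of $P$) contains an independent set of size at least $k+3$. An interval representation of a graph $G=(V,E)$ is a family of intervals of consecutive integers $\{I(v)\}_{v\in V}$ with $uv\in E$ iff $I(u)\cap I(v)\neq\emptyset$ for distinct $u,v$. An interval graph is an exactly hittable interval graph if it has an interval representation admitting a set $T$ of integers with $|T\cap I(v)|=1$ for every $v$. -}

module Defs where

open import Data.Nat using (ℕ; _+_; _≥_)
open import Data.Fin using (Fin; toℕ)
open import Data.Integer using (ℤ; _≤_)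
open import Data.Product using (Σ; ∃; ∃-syntax; _×_)
open import Data.Sum using (_⊎_)
open import Relation.Nullary using (¬_)
open import Relation.Binary.PropositionalEquality using (_≡_)
open import Function.Definitions using (Injective)

record Graph : Set₁ where
  field
    n     : ℕ
    Adj   : Fin n → Fin n → Set
    sym   : ∀ {u v} → Adj u v → Adj v u
    irrefl : ∀ {v} → ¬ Adj v v

open Graph public

InducedSubgraph : Graph → Graph → Set
InducedSubgraph F G =
  Σ (Fin (n F) → Fin (n G)) λ f →
    Injective _≡_ _≡_ f ×
    (∀ u v → (Adj F u v → Adj G (f u) (f v)) × (Adj G (f u) (f v) → Adj F u v))

record Interval : Set where
  constructor [_,_]⟨_⟩
  field
    lo : ℤ
    hi : ℤ
    lo≤hi : lo ≤ hi

open Interval public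

_∈I_ : ℤ → Interval → Set
x ∈I I = lo I ≤ x × x ≤ hi I

Meets : Interval → Interval → Set
Meets I J = ∃[ x ] (x ∈I I × x ∈I J)

IsIntervalRep : (G : Graph) → (Fin (n G) → Interval) → Set
IsIntervalRep G I =
  ∀ u v → ¬ u ≡ v → (Adj G u v → Meets (I u) (I v)) × (Meets (I u) (I v) → Adj G u v)

IntervalGraph : Graph → Set
IntervalGraph G = ∃[ I ] IsIntervalRep G I

HitsExactlyOnce : (ℤ → Set) → Interval → Set
HitsExactlyOnce T I =
  (∃[ t ] (T t × t ∈I I)) ×
  (∀ s t → T s → s ∈I I → T t → t ∈I I → s ≡ t)

ExactlyHittable : Graph → Set₁
ExactlyHittable G =
  Σ (Fin (n G) → Interval) λ I → IsIntervalRep G I ×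
    Σ (ℤ → Set) λ T → ∀ v → HitsExactlyOnce T (I v)

Consecutive : ∀ {k} → Fin k → Fin k → Set
Consecutive i j = toℕ j ≡ toℕ i + 1 ⊎ toℕ i ≡ toℕ j + 1

IsInducedPath : (G : Graph) (k : ℕ) → (Fin k → Fin (n G)) → Set
IsInducedPath G k p =
  Injective _≡_ _≡_ p ×
  (∀ i j → (Adj G (p i) (p j) → Consecutive i j) × (Consecutive i j → Adj G (p i) (p j)))

InOpenNbhd : (G : Graph) {k : ℕ} → (Fin k → Fin (n G)) → Fin (n G) → Set
InOpenNbhd G {k} p v = (∀ i → ¬ p i ≡ v) × ∃[ i ] Adj G (p i) v

InFamily : Graph → Set
InFamily F =
  IntervalGraph F ×
  Σ ℕ λ k → k ≥ 1 ×
    Σ (Fin k → Fin (n F)) λ p → IsInducedPath F k p ×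
      Σ ℕ λ m → m ≥ k + 3 ×
        Σ (Fin m → Fin (n F)) λ s →
          Injective _≡_ _≡_ s ×
          (∀ j → InOpenNbhd F p (s j)) ×
          (∀ i j → ¬ Adj F (s i) (s j))

-- The intervals of the embedded path P form a chain whose union is an interval U.
-- Let T hit every interval exactly once and give each of the k + 3 pairwise disjoint
-- neighbour intervals its hitting point. A point inside U lies in some interval of P,
-- which T hits only once, so two neighbours cannot use the same interval of P; and
-- two neighbours cannot both have their point to the left (or right) of U, since a
-- neighbour meets U and so would contain the other's point. With at most k + 2
-- places available, two neighbours collide.
module Submission where

open import Defs hiding (sym)
open import Data.Nat as ℕ using (suc)
import Data.Nat.Properties as ℕ
open import Data.Fin using (Fin; toℕ; inject₁) renaming (zero to fzero; suc to fsuc)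
open import Data.Fin.Induction using (<-weakInduction)
open import Data.Fin.Properties
  using (toℕ-inject₁; suc-injective; <⇒≢; any?; all?; ¬∀⟶∃¬; pigeonhole)
open import Data.Integer using (ℤ; _≤_; _<_; _≤?_; _<?_)
open import Data.Integer.Properties
  using (≤-trans; ≤-total; <⇒≤; ≤-<-trans; <-≤-trans; <-irrefl; ≰⇒>)
open import Data.Product using (∃-syntax; _×_; _,_; proj₁; proj₂)
open import Data.Sum using (_⊎_; inj₁; inj₂)
open import Data.Empty using (⊥-elim)
open import Function using (_∘_)
open import Relation.Nullary using (¬_; yes; no; contradiction)
open import Relation.Nullary.Decidable using (_×-dec_)
open import Relation.Binary.PropositionalEquality using (_≡_; _≢_; refl; sym; trans; cong; subst)

toℕ-suc≡toℕ-inject₁+1 : ∀ {k} (i : Fin k) → toℕ (fsuc i) ≡ toℕ (inject₁ i) ℕ.+ 1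
toℕ-suc≡toℕ-inject₁+1 i = sym (trans (cong (ℕ._+ 1) (toℕ-inject₁ i)) (ℕ.+-comm (toℕ i) 1))

Consecutive-closed⇒constant : ∀ {k} (P : Fin k → Set) →
  (∀ i j → Consecutive i j → P i → P j) → ∀ a b → P a → P b
Consecutive-closed⇒constant {suc k} P closed a b Pa =
  proj₂ (like-zero b) (proj₁ (like-zero a) Pa)
  where
  like-zero : ∀ i → (P i → P fzero) × (P fzero → P i)
  like-zero = <-weakInduction _ ((λ p → p) , (λ p → p)) λ i (to , from) →
    let e = toℕ-suc≡toℕ-inject₁+1 i in
    (to ∘ closed (fsuc i) (inject₁ i) (inj₂ e)) , (closed (inject₁ i) (fsuc i) (inj₁ e) ∘ from)

∈I-convex : ∀ A {s t x} → s ∈I A → t ∈I A → s ≤ x → x ≤ t → x ∈I A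
∈I-convex _ (lo≤s , _) (_ , t≤hi) s≤x x≤t = ≤-trans lo≤s s≤x , ≤-trans x≤t t≤hi

∉I⇒<lo⊎hi< : ∀ {t} A → ¬ t ∈I A → t < lo A ⊎ hi A < t
∉I⇒<lo⊎hi< {t} A t∉A with lo A ≤? t
... | no lo≰t = inj₁ (≰⇒> lo≰t)
... | yes lo≤t = inj₂ (≰⇒> λ t≤hi → t∉A (lo≤t , t≤hi))

Meets⇒¬<lo×hi< : ∀ A B {t} → Meets A B → t < lo A → ¬ hi B < t
Meets⇒¬<lo×hi< _ _ (x , (lo≤x , _) , (_ , x≤hi)) t<lo hi<t =
  <-irrefl refl (<-≤-trans t<lo (≤-trans lo≤x (≤-trans x≤hi (<⇒≤ hi<t))))

module Chain {k} (J : Fin k → Interval)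
             (chain : ∀ i j → Consecutive i j → Meets (J i) (J j)) where

  Covered : ℤ → Set
  Covered t = ∃[ i ] t ∈I J i

  Near : Interval → Set
  Near A = ∃[ i ] Meets (J i) A

  data Position (t : ℤ) : Set where
    covered : Covered t → Position t
    leftOf  : (∀ i → t < lo (J i)) → Position t
    rightOf : (∀ i → hi (J i) < t) → Position t

  leftOf-closed : ∀ {t} → ¬ Covered t → ∀ i j → Consecutive i j → t < lo (J i) → t < lo (J j)
  leftOf-closed t∉ i j c t<i with ∉I⇒<lo⊎hi< (J j) (λ t∈ → t∉ (j , t∈))
  ... | inj₁ t<j = t<j
  ... | inj₂ j<t = ⊥-elim (Meets⇒¬<lo×hi< (J i) (J j) (chain i j c) t<i j<t)

  position : ∀ t → Position t
  position t with any? (λ i → (lo (J i) ≤? t) ×-dec (t ≤? hi (J i)))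
  ... | yes t∈ = covered t∈
  ... | no t∉ with all? (λ i → hi (J i) <? t)
  ...   | yes right = rightOf right
  ...   | no ¬right with ¬∀⟶∃¬ k _ (λ i → hi (J i) <? t) ¬right
  ...     | a , a≮t with ∉I⇒<lo⊎hi< (J a) (λ t∈ → t∉ (a , t∈))
  ...       | inj₂ a<t = contradiction a<t a≮t
  ...       | inj₁ t<a = leftOf λ i →
                Consecutive-closed⇒constant _ (leftOf-closed t∉) a i t<a

  leftOf-squeeze : ∀ B {s t} → Near B → t ∈I B → (∀ i → s < lo (J i)) → t ≤ s → s ∈I B
  leftOf-squeeze B (i , x , (lo≤x , _) , x∈B) t∈B left t≤s =
    ∈I-convex B t∈B x∈B t≤s (<⇒≤ (<-≤-trans (left i) lo≤x))

  rightOf-squeeze : ∀ B {s t} → Near B → t ∈I B → (∀ i → hi (J i) < s) → s ≤ t → s ∈I B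
  rightOf-squeeze B (i , x , (_ , x≤hi) , x∈B) t∈B right s≤t =
    ∈I-convex B x∈B t∈B (<⇒≤ (≤-<-trans x≤hi (right i))) s≤t

  module Hitting (T : ℤ → Set)
                 (hit-once : ∀ i s t → T s → s ∈I J i → T t → t ∈I J i → s ≡ t) where

    place : ∀ {t} → Position t → Fin (2 ℕ.+ k)
    place (covered (i , _)) = fsuc (fsuc i)
    place (leftOf _)        = fzero
    place (rightOf _)       = fsuc fzero

    same-place⇒Meets : ∀ A B {s t} → Near A → Near B →
      T s → s ∈I A → T t → t ∈I B →
      (p : Position s) (q : Position t) → place p ≡ place q → Meets A B
    same-place⇒Meets _ B {s} _ _ Ts s∈A Tt t∈B (covered (i , s∈J)) (covered (i′ , t∈J)) e
      with suc-injective (suc-injective e)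
    ... | refl = s , s∈A , subst (_∈I B) (sym (hit-once i s _ Ts s∈J Tt t∈J)) t∈B
    same-place⇒Meets A B {s} {t} nA nB _ s∈A _ t∈B (leftOf s<) (leftOf t<) _ with ≤-total s t
    ... | inj₁ s≤t = t , leftOf-squeeze A nA s∈A t< s≤t , t∈B
    ... | inj₂ t≤s = s , s∈A , leftOf-squeeze B nB t∈B s< t≤s
    same-place⇒Meets A B {s} {t} nA nB _ s∈A _ t∈B (rightOf <s) (rightOf <t) _ with ≤-total s t
    ... | inj₁ s≤t = s , s∈A , rightOf-squeeze B nB t∈B <s s≤t
    ... | inj₂ t≤s = t , rightOf-squeeze A nA s∈A <t t≤s , t∈B
    same-place⇒Meets _ _ _ _ _ _ _ _ (covered _) (leftOf _)  ()
    same-place⇒Meets _ _ _ _ _ _ _ _ (covered _) (rightOf _) ()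
    same-place⇒Meets _ _ _ _ _ _ _ _ (leftOf _)  (covered _) ()
    same-place⇒Meets _ _ _ _ _ _ _ _ (leftOf _)  (rightOf _) ()
    same-place⇒Meets _ _ _ _ _ _ _ _ (rightOf _) (covered _) ()
    same-place⇒Meets _ _ _ _ _ _ _ _ (rightOf _) (leftOf _)  ()

    disjoint-hit-near-intervals-≤ : ∀ {m} (K : Fin m → Interval) →
      (∀ j → Near (K j)) → (∀ j → ∃[ t ] (T t × t ∈I K j)) →
      (∀ j j′ → j ≢ j′ → ¬ Meets (K j) (K j′)) → m ℕ.≤ 2 ℕ.+ k
    disjoint-hit-near-intervals-≤ {m} K near hit disjoint = ℕ.≮⇒≥ λ 2+k<m →
      let (j , j′ , j<j′ , same) = pigeonhole 2+k<m (place ∘ position ∘ point) in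
      disjoint j j′ (<⇒≢ j<j′)
        (same-place⇒Meets (K j) (K j′) (near j) (near j′)
          (T-point j) (∈K-point j) (T-point j′) (∈K-point j′)
          (position (point j)) (position (point j′)) same)
      where
      point : Fin m → ℤ
      point j = proj₁ (hit j)
      T-point : ∀ j → T (point j)
      T-point j = proj₁ (proj₂ (hit j))
      ∈K-point : ∀ j → point j ∈I K j
      ∈K-point j = proj₂ (proj₂ (hit j))

module Representation {G : Graph} {I : Fin (n G) → Interval} (rep : IsIntervalRep G I) where

  Adj⇒Meets : ∀ {u v} → Adj G u v → Meets (I u) (I v)
  Adj⇒Meets {u} {v} uv = proj₁ (rep u v λ { refl → irrefl G uv }) uv

  Meets⇒Adj : ∀ {u v} → u ≢ v → Meets (I u) (I v) → Adj G u v
  Meets⇒Adj {u} {v} u≢v = proj₂ (rep u v u≢v)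

lemma2 : (G F : Graph) → IntervalGraph G → InFamily F → InducedSubgraph F G → ¬ ExactlyHittable G
lemma2 G F _ (_ , k , _ , p , (_ , path) , m , k+3≤m , s , s-inj , s-near , s-indep)
       (f , f-inj , f-adj) (I , rep , T , hit) =
  ℕ.n≮n (2 ℕ.+ k) (subst (ℕ._≤ 2 ℕ.+ k) (ℕ.+-comm k 3) (ℕ.≤-trans k+3≤m m≤2+k))
  where
  open Representation {G} {I} rep

  J : Fin k → Interval
  J i = I (f (p i))
  K : Fin m → Interval
  K j = I (f (s j))

  chain : ∀ i j → Consecutive i j → Meets (J i) (J j)
  chain i j c = Adj⇒Meets (proj₁ (f-adj (p i) (p j)) (proj₂ (path i j) c))

  open Chain J chain
  open Hitting T (λ i → proj₂ (hit (f (p i))))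

  near : ∀ j → Near (K j)
  near j = let (i , ad) = proj₂ (s-near j) in i , Adj⇒Meets (proj₁ (f-adj (p i) (s j)) ad)

  disjoint : ∀ j j′ → j ≢ j′ → ¬ Meets (K j) (K j′)
  disjoint j j′ j≢j′ meet =
    s-indep j j′ (proj₂ (f-adj (s j) (s j′)) (Meets⇒Adj (j≢j′ ∘ s-inj ∘ f-inj) meet))

  m≤2+k : m ℕ.≤ 2 ℕ.+ k
  m≤2+k = disjoint-hit-near-intervals-≤ K near (λ j → proj₁ (hit (f (s j)))) disjoint
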